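{- For every positive integer $n$, during a complete run of $\mathrm{AccelAsc}(n)$, the visit statement "visit $\langle a_1,\dots,a_\ell\rangle$" inside the loop "while $x\le y$" is executed exactly $p(n-2)$ times.
   Context: $p(n)$ denotes the number of partitions of $n$, with the conventions $p(0)=1$ and $p(j)=0$ for $j<0$. The procedure $\mathrm{AccelAsc}(n)$, for $n\ge1$, operates on an array $a$ as follows and visits every ascending composition of $n$ (a sequence of positive integers in nondecreasing order summing to $n$) exactly once: 1. $k\leftarrow 2$; $a_1\leftarrow 0$; $y\leftarrow n-1$. 2. While $k\ne 1$: - $k\leftarrow k-1$; $x\leftarrow a_k+1$. - While $2x\le y$: $a_k\leftarrow x$; $y\leftarrow y-x$; $k\leftarrow k+1$. - $\ell\leftarrow k+1$. - While $x\le y$: $a_k\leftarrow x$; $a_\ell\leftarrow y$; visit $\langle a_1,\dots,a_\ell\rangle$; $x\leftarrow x+1$; $y\leftarrow y-1$. - $y\leftarrow y+x-1$; $a_k\leftarrow y+1$; visit $\langle a_1,\dots,a_k\rangle$. -}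

module Defs where

open import Data.Nat using (ℕ; zero; suc; _+_; _*_; _∸_; _≤_; _≤?_; _≟_)
open import Data.Integer using (ℤ; +_; -[1+_])
open import Data.List using (List)
open import Data.Nat.ListAction using (sum)
open import Data.List.Relation.Unary.All using (All)
open import Data.List.Relation.Unary.Linked using (Linked)
open import Data.Maybe using (Maybe; just; nothing)
open import Data.Product using (Σ; _×_; _,_)
open import Data.Empty using (⊥)
open import Relation.Binary.PropositionalEquality using (_≡_)
open import Relation.Nullary using (yes; no)

-- Partitions.
-- A partition of m is a multiset of positive integers summing to m,
-- represented canonically as a nondecreasing list of positive integers.

IsPartition : ℕ → List ℕ → Set
IsPartition m xs = All (1 ≤_) xs × Linked _≤_ xs × sum xs ≡ m

PartitionOf : ℕ → Set
PartitionOf m = Σ (List ℕ) (IsPartition m)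

-- Partitions of an integer j; for j < 0 there are none (p(j) = 0).
PartitionOfℤ : ℤ → Set
PartitionOfℤ (+ m)     = PartitionOf m
PartitionOfℤ -[1+ _ ]  = ⊥

-- The procedure AccelAsc(n), interpreted with a fuel bound.
-- The array a is modelled as a function ℕ → ℕ (index ↦ entry),
-- initially 0 everywhere (only a₁ ← 0 is prescribed; the other initial
-- entries are never read before being written).
-- We only record how many times the visit statement inside the
-- "while x ≤ y" loop is executed (the counter `cnt`).

Array : Set
Array = ℕ → ℕ

upd : Array → ℕ → ℕ → Array
upd a i v j with j ≟ i
... | yes _ = v
... | no  _ = a j

-- while 2x ≤ y : a_k ← x ; y ← y - x ; k ← k + 1
-- result: (k , y , a)
loop1 : (fuel k x y : ℕ) → Array → Maybe (ℕ × ℕ × Array)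
loop1 zero       k x y a = nothing
loop1 (suc fuel) k x y a with (2 * x) ≤? y
... | yes _ = loop1 fuel (suc k) x (y ∸ x) (upd a k x)
... | no  _ = just (k , y , a)

-- while x ≤ y : a_k ← x ; a_ℓ ← y ; visit ; x ← x + 1 ; y ← y - 1
-- result: (x , y , a , cnt)
loop2 : (fuel k ℓ x y : ℕ) → Array → (cnt : ℕ) → Maybe (ℕ × ℕ × Array × ℕ)
loop2 zero       k ℓ x y a cnt = nothing
loop2 (suc fuel) k ℓ x y a cnt with x ≤? y
... | yes _ = loop2 fuel k ℓ (suc x) (y ∸ 1) (upd (upd a k x) ℓ y) (suc cnt)
... | no  _ = just (x , y , a , cnt)

outer : (fuel k y : ℕ) → Array → (cnt : ℕ) → Maybe ℕ
outer zero       k y a cnt = nothing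
outer (suc fuel) k y a cnt with k ≟ 1
... | yes _ = just cnt
... | no  _ with k ∸ 1
...   | k₁ with loop1 fuel k₁ (a k₁ + 1) y a
...     | nothing = nothing
...     | just (k₂ , y₂ , a₂) with loop2 fuel k₂ (suc k₂) (a k₁ + 1) y₂ a₂ cnt
...       | nothing = nothing
...       | just (x₃ , y₃ , a₃ , cnt₃) =
            let y₄ = (y₃ + x₃) ∸ 1 in
            outer fuel k₂ y₄ (upd a₃ k₂ (suc y₄)) cnt₃

-- A run of AccelAsc(n) with the given fuel: `just c` iff the run
-- terminates within the fuel, with c executions of the inner visit.
accelAscInnerVisits : (fuel n : ℕ) → Maybe ℕ
accelAscInnerVisits fuel n = outer fuel 2 (n ∸ 1) (upd (λ _ → 0) 1 0) 0

module Submission where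

-- The inner visit of AccelAsc(n) is counted by a recursion on the frames of
-- the outer loop.  A frame at array position j with trial value x and
-- remaining amount y lays out all ascending tails with parts ≥ x; we show
-- that (for x ≤ y) it performs exactly as many inner visits as there are
-- partitions of x + y ∸ 2 into parts ≥ x, and then returns to the outer
-- loop at position j (Frame, frame).
--
-- For n ≥ 2 the run of AccelAsc(n) is the frame (1, n ∸ 1) at position 1,
-- giving p(n ∸ 2); the case n = 1 is a direct computation.

open import Defs
open import Data.Nat
open import Data.Nat.Properties
open import Data.Nat.Induction using (<-rec)
open import Data.Nat.ListAction using (sum)
open import Data.List using (List; []; _∷_)
open import Data.List.Relation.Unary.All as All using (All; []; _∷_)
open import Data.List.Relation.Unary.Linked as Linked using (Linked; []; [-]; _∷_)
open import Data.List.Relation.Unary.Linked.Properties using (Linked⇒All)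
open import Data.Fin as Fin using (Fin)
open import Data.Fin.Properties using (+↔⊎)
open import Data.Maybe using (Maybe; just; nothing)
open import Data.Product using (Σ; _×_; _,_; proj₁)
open import Data.Sum using (_⊎_; inj₁; inj₂)
open import Data.Sum.Function.Propositional using (_⊎-↔_)
open import Data.Empty using (⊥; ⊥-elim)
open import Function.Base using (_∘_)
open import Function.Bundles using (_↔_; mk↔ₛ′)
open import Function.Properties.Inverse using (↔-trans; ↔-sym; ↔-refl)
open import Relation.Binary.PropositionalEquality
open import Relation.Nullary using (¬_; Dec; yes; no)

empty↔Fin0 : ∀ {A : Set} → ¬ A → Fin 0 ↔ A
empty↔Fin0 ¬a = mk↔ₛ′ (λ ()) (λ a → ⊥-elim (¬a a)) (λ a → ⊥-elim (¬a a)) (λ ())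

singleton↔Fin1 : ∀ {A : Set} → A → (∀ (p q : A) → p ≡ q) → Fin 1 ↔ A
singleton↔Fin1 a unique =
  mk↔ₛ′ (λ _ → a) (λ _ → Fin.zero) (unique a) (λ { Fin.zero → refl ; (Fin.suc ()) })

+1∸1 : ∀ x z → x + suc z ∸ 1 ≡ x + z
+1∸1 x z = cong (_∸ 1) (+-suc x z)

+2∸2 : ∀ x z → x + suc (suc z) ∸ 2 ≡ x + z
+2∸2 x z = trans (cong (_∸ 2) (+-suc x (suc z))) (+1∸1 x z)

double : ∀ x → 2 * x ≡ x + x
double x = cong (x +_) (+-identityʳ x)

Part : ℕ → ℕ → Set
Part x m = Σ (List ℕ) (λ xs → All (x ≤_) xs × Linked _≤_ xs × sum xs ≡ m)

Part-≡ : ∀ {x m} (p q : Part x m) → proj₁ p ≡ proj₁ q → p ≡ q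
Part-≡ (xs , a , l , s) (.xs , a′ , l′ , s′) refl
  rewrite All.irrelevant ≤-irrelevant a a′
        | Linked.irrelevant ≤-irrelevant l l′
        | ≡-irrelevant s s′ = refl

Part-cong : ∀ {x m m′} → m ≡ m′ → Part x m ↔ Part x m′
Part-cong refl = ↔-refl

Fin-cong : ∀ {m m′} → m ≡ m′ → Fin m ↔ Fin m′
Fin-cong refl = ↔-refl

Part-empty : ∀ {x m} → 0 < m → m < x → ¬ Part x m
Part-empty 0<m _ ([] , _ , _ , refl) = <-irrefl refl 0<m
Part-empty _ m<x (a ∷ r , x≤a ∷ _ , _ , s) =
  <⇒≱ m<x (≤-trans x≤a (≤-trans (m≤m+n a (sum r)) (≤-reflexive s)))

-- Below 2x a partition into parts ≥ x has at most one part, so it is unique.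
Part-unique : ∀ {x m} → 1 ≤ x → m < 2 * x → (p q : Part x m) → p ≡ q
Part-unique {x} {m} 1≤x m<2x p q = Part-≡ p q (sameParts p q)
  where
  noTwoParts : ∀ {a b r} → x ≤ a → x ≤ b → a + (b + sum r) ≡ m → ⊥
  noTwoParts {a} {b} {r} x≤a x≤b s = <⇒≱ m<2x (begin
    2 * x              ≡⟨ double x ⟩
    x + x              ≤⟨ +-mono-≤ x≤a (≤-trans x≤b (m≤m+n b (sum r))) ⟩
    a + (b + sum r)    ≡⟨ s ⟩
    m                  ∎)
    where open ≤-Reasoning

  noEmptyAndSingle : ∀ {e} → x ≤ e → e + 0 ≡ m → 0 ≡ m → ⊥
  noEmptyAndSingle {e} x≤e s s₀ =
    <⇒≱ (≤-trans 1≤x x≤e) (≤-reflexive (trans (sym (+-identityʳ e)) (trans s (sym s₀))))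

  sameParts : (p q : Part x m) → proj₁ p ≡ proj₁ q
  sameParts ([] , _) ([] , _) = refl
  sameParts ([] , _ , _ , s₀) (e ∷ [] , x≤e ∷ [] , _ , s) = ⊥-elim (noEmptyAndSingle x≤e s s₀)
  sameParts (e ∷ [] , x≤e ∷ [] , _ , s) ([] , _ , _ , s₀) = ⊥-elim (noEmptyAndSingle x≤e s s₀)
  sameParts (e ∷ [] , _ , _ , s) (e′ ∷ [] , _ , _ , s′) =
    cong (_∷ []) (trans (sym (+-identityʳ e)) (trans s (trans (sym s′) (+-identityʳ e′))))
  sameParts (a ∷ b ∷ r , x≤a ∷ x≤b ∷ _ , _ , s) _ = ⊥-elim (noTwoParts {r = r} x≤a x≤b s)
  sameParts _ (a ∷ b ∷ r , x≤a ∷ x≤b ∷ _ , _ , s) = ⊥-elim (noTwoParts {r = r} x≤a x≤b s)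

Part-single : ∀ {x m} → 1 ≤ x → m < 2 * x → m ≡ 0 ⊎ x ≤ m → Fin 1 ↔ Part x m
Part-single 1≤x m<2x (inj₁ refl) = singleton↔Fin1 ([] , [] , [] , refl) (Part-unique 1≤x m<2x)
Part-single {m = m} 1≤x m<2x (inj₂ x≤m) =
  singleton↔Fin1 (m ∷ [] , x≤m ∷ [] , [-] , +-identityʳ m) (Part-unique 1≤x m<2x)

-- The basic recurrence: a partition of m into parts ≥ x either has smallest
-- part x (remove it) or has all parts ≥ x + 1.
module _ {x m : ℕ} (1≤x : 1 ≤ x) (x≤m : x ≤ m) where

  private
    notEmpty : sum [] ≡ m → ⊥
    notEmpty s = <⇒≱ (≤-trans 1≤x x≤m) (≤-reflexive (sym s))

    consMin : ∀ {t} → All (x ≤_) t → Linked _≤_ t → Linked _≤_ (x ∷ t)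
    consMin [] _ = [-]
    consMin (x≤y ∷ _) l = x≤y ∷ l

    removeMin : Part x m → Part x (m ∸ x) ⊎ Part (suc x) m
    removeMin ([] , _ , _ , s) = ⊥-elim (notEmpty s)
    removeMin (h ∷ t , x≤h ∷ at , l , s) with h ≟ x
    ... | yes refl = inj₁ (t , at , Linked.tail l , trans (sym (m+n∸m≡n h (sum t))) (cong (_∸ h) s))
    ... | no h≢x = inj₂ (h ∷ t , Linked⇒All ≤-trans (≤∧≢⇒< x≤h (h≢x ∘ sym)) l , l , s)

    addMin : Part x (m ∸ x) ⊎ Part (suc x) m → Part x m
    addMin (inj₁ (t , at , l , s)) =
      x ∷ t , ≤-refl ∷ at , consMin at l , trans (cong (x +_) s) (m+[n∸m]≡n x≤m)
    addMin (inj₂ (xs , a , l , s)) = xs , All.map (≤-trans (n≤1+n x)) a , l , s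

    addMin-removeMin : ∀ p → addMin (removeMin p) ≡ p
    addMin-removeMin ([] , _ , _ , s) = ⊥-elim (notEmpty s)
    addMin-removeMin p@(h ∷ t , x≤h ∷ _ , _ , _) with h ≟ x
    ... | yes refl = Part-≡ _ p refl
    ... | no _ = Part-≡ _ p refl

    removeMin-addMin : ∀ q → removeMin (addMin q) ≡ q
    removeMin-addMin (inj₁ _) with x ≟ x
    ... | yes refl = cong inj₁ (Part-≡ _ _ refl)
    ... | no x≢x = ⊥-elim (x≢x refl)
    removeMin-addMin (inj₂ ([] , _ , _ , s)) = ⊥-elim (notEmpty s)
    removeMin-addMin (inj₂ (h ∷ _ , x<h ∷ _ , _ , _)) with h ≟ x
    ... | yes refl = ⊥-elim (<-irrefl refl x<h)
    ... | no _ = cong inj₂ (Part-≡ _ _ refl)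

  split : Part x m ↔ (Part x (m ∸ x) ⊎ Part (suc x) m)
  split = mk↔ₛ′ removeMin addMin removeMin-addMin addMin-removeMin

-- Number of iterations of the loop started at (x , y) with x ≥ 1: it
-- visits (x , y), (x+1 , y-1), … as long as the first entry is ≤ the second.
sweeps : ℕ → ℕ → ℕ
sweeps x zero = 0
sweeps x (suc y) with x ≤? suc y
... | yes _ = suc (sweeps (suc x) y)
... | no  _ = 0

sweeps-none : ∀ {x y} → y < x → sweeps x y ≡ 0
sweeps-none {x} {zero} _ = refl
sweeps-none {x} {suc y} y<x with x ≤? suc y
... | yes x≤y = ⊥-elim (<⇒≱ y<x x≤y)
... | no  _   = refl

sweeps-step : ∀ {x y} → x ≤ suc y → sweeps x (suc y) ≡ suc (sweeps (suc x) y)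
sweeps-step {x} {y} x≤y with x ≤? suc y
... | yes _   = refl
... | no  x≰y = ⊥-elim (x≰y x≤y)

-- One step of a sweep below 2x: given the count for the rest of the sweep
-- (partitions with parts ≥ x + 1), the first visited pair accounts for the
-- unique partition of x + z with smallest part x (Part-single) and split
-- combines the two; if the rest of the sweep is empty, Part x (x + z) is
-- the single partition [x + z].
sweep-step-counts : ∀ {x z} → 1 ≤ x → suc (suc z) < 2 * x →
  (suc x ≤ suc z → Fin (sweeps (suc x) (suc z)) ↔ Part (suc x) (x + z)) →
  Fin (suc (sweeps (suc x) (suc z))) ↔ Part x (x + z)
sweep-step-counts {x} {z} 1≤x y<2x rest = byComparison (suc x ≤? suc z)
  where
  byComparison : Dec (suc x ≤ suc z) → Fin (suc (sweeps (suc x) (suc z))) ↔ Part x (x + z)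
  byComparison (yes x<y) =
    ↔-trans (+↔⊎ {1} {sweeps (suc x) (suc z)})
      (↔-trans (smallest ⊎-↔ rest x<y) (↔-sym (split 1≤x (m≤m+n x z))))
    where
    smallest : Fin 1 ↔ Part x (x + z ∸ x)
    smallest = ↔-trans (Part-single 1≤x (<-trans (n<1+n z) (<-trans (n<1+n _) y<2x)) (inj₂ (≤-pred x<y)))
                       (Part-cong (sym (m+n∸m≡n x z)))
  byComparison (no x≮y) rewrite sweeps-none (≰⇒> x≮y) =
    Part-single 1≤x x+z<2x (inj₂ (m≤m+n x z))
    where
    x+z<2x : x + z < 2 * x
    x+z<2x = subst (x + z <_) (sym (double x)) (+-monoʳ-< x (≤-pred (≰⇒> x≮y)))

y-1<2[x+1] : ∀ {x z} → suc (suc z) < 2 * x → suc z < 2 * suc x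
y-1<2[x+1] {x} y<2x = <-trans (n<1+n _) (<-≤-trans y<2x (*-monoʳ-≤ 2 (n≤1+n x)))

sweeps-counts : ∀ {x y} → 1 ≤ x → x ≤ y → y < 2 * x → Fin (sweeps x y) ↔ Part x (x + y ∸ 2)
sweeps-counts {x} {zero} 1≤x x≤0 _ = ⊥-elim (<⇒≱ 1≤x x≤0)
sweeps-counts {suc zero} {suc zero} _ _ _ = Part-single ≤-refl (s≤s z≤n) (inj₁ refl)
sweeps-counts {suc (suc x)} {suc zero} _ (s≤s ()) _
sweeps-counts {x} {suc (suc z)} 1≤x x≤y y<2x =
  ↔-trans (Fin-cong (sweeps-step x≤y))
    (↔-trans (sweep-step-counts 1≤x y<2x (λ x<y →
               ↔-trans (sweeps-counts (s≤s z≤n) x<y (y-1<2[x+1] y<2x)) (Part-cong (+1∸1 x z))))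
             (Part-cong (sym (+2∸2 x z))))

upd-eq : ∀ a i v → upd a i v i ≡ v
upd-eq a i v with i ≟ i
... | yes _   = refl
... | no  i≢i = ⊥-elim (i≢i refl)

upd-below : ∀ a i v j → j < i → upd a i v j ≡ a j
upd-below a i v j j<i with j ≟ i
... | yes j≡i = ⊥-elim (<-irrefl j≡i j<i)
... | no  _   = refl

loop1-continue : ∀ f k x y a → 2 * x ≤ y →
  loop1 (suc f) k x y a ≡ loop1 f (suc k) x (y ∸ x) (upd a k x)
loop1-continue f k x y a 2x≤y with 2 * x ≤? y
... | yes _    = refl
... | no  2x≰y = ⊥-elim (2x≰y 2x≤y)

loop1-exit : ∀ f k x y a → y < 2 * x → loop1 (suc f) k x y a ≡ just (k , y , a)
loop1-exit f k x y a y<2x with 2 * x ≤? y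
... | yes 2x≤y = ⊥-elim (<⇒≱ y<2x 2x≤y)
... | no  _    = refl

loop2-continue : ∀ f k ℓ x y a cnt → x ≤ y →
  loop2 (suc f) k ℓ x y a cnt ≡ loop2 f k ℓ (suc x) (y ∸ 1) (upd (upd a k x) ℓ y) (suc cnt)
loop2-continue f k ℓ x y a cnt x≤y with x ≤? y
... | yes _   = refl
... | no  x≰y = ⊥-elim (x≰y x≤y)

loop2-exit : ∀ f k ℓ x y a cnt → y < x → loop2 (suc f) k ℓ x y a cnt ≡ just (x , y , a , cnt)
loop2-exit f k ℓ x y a cnt y<x with x ≤? y
... | yes x≤y = ⊥-elim (<⇒≱ y<x x≤y)
... | no  _   = refl

-- The part of an iteration of the outer loop after loop1 (resp. loop2) has
-- returned, including the remaining iterations of the outer loop.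
afterLoop2 : (fuel k : ℕ) → Maybe (ℕ × ℕ × Array × ℕ) → Maybe ℕ
afterLoop2 f k nothing = nothing
afterLoop2 f k (just (x₃ , y₃ , a₃ , cnt₃)) =
  outer f k ((y₃ + x₃) ∸ 1) (upd a₃ k (suc ((y₃ + x₃) ∸ 1))) cnt₃

afterLoop1 : (fuel x cnt : ℕ) → Maybe (ℕ × ℕ × Array) → Maybe ℕ
afterLoop1 f x cnt nothing = nothing
afterLoop1 f x cnt (just (k₂ , y₂ , a₂)) = afterLoop2 f k₂ (loop2 f k₂ (suc k₂) x y₂ a₂ cnt)

outer-step : ∀ f k y a cnt → k ≢ 1 →
  outer (suc f) k y a cnt ≡ afterLoop1 f (a (k ∸ 1) + 1) cnt (loop1 f (k ∸ 1) (a (k ∸ 1) + 1) y a)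
outer-step f k y a cnt k≢1 with k ≟ 1
... | yes k≡1 = ⊥-elim (k≢1 k≡1)
... | no  _ with loop1 f (k ∸ 1) (a (k ∸ 1) + 1) y a
...   | nothing = refl
...   | just (k₂ , y₂ , a₂) with loop2 f k₂ (suc k₂) (a (k ∸ 1) + 1) y₂ a₂ cnt
...     | nothing = refl
...     | just _  = refl

loop1-mono : ∀ f k x y a r → loop1 f k x y a ≡ just r → loop1 (suc f) k x y a ≡ just r
loop1-mono (suc f) k x y a r e with 2 * x ≤? y
... | yes _ = loop1-mono f (suc k) x (y ∸ x) (upd a k x) r e
... | no  _ = e

loop2-mono : ∀ f k ℓ x y a cnt r → loop2 f k ℓ x y a cnt ≡ just r → loop2 (suc f) k ℓ x y a cnt ≡ just r
loop2-mono (suc f) k ℓ x y a cnt r e with x ≤? y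
... | yes _ = loop2-mono f k ℓ (suc x) (y ∸ 1) (upd (upd a k x) ℓ y) (suc cnt) r e
... | no  _ = e

outer-mono : ∀ f k y a cnt r → outer f k y a cnt ≡ just r → outer (suc f) k y a cnt ≡ just r
afterLoop1-mono : ∀ f x cnt m m′ r → (∀ v → m ≡ just v → m′ ≡ just v) →
  afterLoop1 f x cnt m ≡ just r → afterLoop1 (suc f) x cnt m′ ≡ just r
afterLoop2-mono : ∀ f k m m′ r → (∀ v → m ≡ just v → m′ ≡ just v) →
  afterLoop2 f k m ≡ just r → afterLoop2 (suc f) k m′ ≡ just r

outer-mono (suc f) k y a cnt r e = byTest (k ≟ 1)
  where
  byTest : Dec (k ≡ 1) → outer (suc (suc f)) k y a cnt ≡ just r
  byTest (yes refl) = e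
  byTest (no k≢1) rewrite outer-step (suc f) k y a cnt k≢1 =
    afterLoop1-mono f (a (k ∸ 1) + 1) cnt _ _ r (loop1-mono f (k ∸ 1) (a (k ∸ 1) + 1) y a)
      (trans (sym (outer-step f k y a cnt k≢1)) e)

afterLoop1-mono f x cnt (just v@(k₂ , y₂ , a₂)) m′ r lift e rewrite lift v refl =
  afterLoop2-mono f k₂ _ _ r (loop2-mono f k₂ (suc k₂) x y₂ a₂ cnt) e

afterLoop2-mono f k (just v@(_ , _ , _ , cnt₃)) m′ r lift e rewrite lift v refl =
  outer-mono f k _ _ cnt₃ r e

outer-mono+ : ∀ d f k y a cnt r → outer f k y a cnt ≡ just r → outer (d + f) k y a cnt ≡ just r
outer-mono+ zero    f k y a cnt r e = e
outer-mono+ (suc d) f k y a cnt r e = outer-mono (d + f) k y a cnt r (outer-mono+ d f k y a cnt r e)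

loop2-run : ∀ k x y a → 1 ≤ x →
  Σ ℕ λ x′ → Σ ℕ λ y′ → Σ Array λ a′ →
    (y′ + x′ ≡ x + y) × (∀ i → i < k → a′ i ≡ a i) ×
    (∀ f cnt → y < f → loop2 f k (suc k) x y a cnt ≡ just (x′ , y′ , a′ , cnt + sweeps x y))
loop2-run k x y a 1≤x with x ≤? y
loop2-run k x y a 1≤x | no x≰y =
  x , y , a , +-comm y x , (λ _ _ → refl) , λ where
    (suc f) cnt _ → trans (loop2-exit f k (suc k) x y a cnt (≰⇒> x≰y))
                          (cong (λ c → just (x , y , a , c))
                                (sym (trans (cong (cnt +_) (sweeps-none (≰⇒> x≰y))) (+-identityʳ cnt))))
loop2-run k x zero a 1≤x | yes x≤0 = ⊥-elim (<⇒≱ 1≤x x≤0)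
loop2-run k x (suc y) a 1≤x | yes x≤y
  with loop2-run k (suc x) y (upd (upd a k x) (suc k) (suc y)) (s≤s z≤n)
... | x′ , y′ , a′ , sum≡ , keeps , run =
  x′ , y′ , a′ , trans sum≡ (sym (+-suc x y)) ,
  (λ i i<k → trans (keeps i i<k)
                   (trans (upd-below _ (suc k) _ i (m<n⇒m<1+n i<k)) (upd-below a k x i i<k))) ,
  λ where
    (suc f) cnt (s≤s y<f) →
      trans (loop2-continue f k (suc k) x (suc y) a cnt x≤y)
            (trans (run f (suc cnt) y<f)
                   (cong (λ c → just (x′ , y′ , a′ , c))
                         (trans (sym (+-suc cnt _)) (cong (cnt +_) (sym (sweeps-step x≤y))))))

-- Entering the outer-loop body at array position j with trial value x and
-- remaining amount y (loop1 is about to run), the run makes `visits` inner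
-- visits, which for x ≤ y are counted by Part x (x + y ∸ 2), and then is
-- back in the outer loop at position j with y = x + y ∸ 1, having changed
-- the array only at positions ≥ j.  `fuel` bounds the fuel this needs.
record Frame (x y j : ℕ) (a : Array) : Set where
  field
    visits : ℕ
    array  : Array
    fuel   : ℕ
    keeps  : ∀ i → i < j → array i ≡ a i
    void   : y < x → visits ≡ 0
    counts : x ≤ y → Fin visits ↔ Part x (x + y ∸ 2)
    runs   : ∀ f g cnt r → fuel ≤ f →
             outer g j (x + y ∸ 1) array (cnt + visits) ≡ just r →
             afterLoop1 (fuel + g) x cnt (loop1 f j x y a) ≡ just r

-- A leaf frame (y < 2x): loop1 exits at once and the frame is one sweep.
frame-leaf : ∀ {x y} j a → 1 ≤ x → y < 2 * x → Frame x y j a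
frame-leaf {x} {y} j a 1≤x y<2x with loop2-run j x y a 1≤x
... | x′ , y′ , a′ , sum≡ , keeps , run = record
  { visits = sweeps x y
  ; array  = upd a′ j (suc (x + y ∸ 1))
  ; fuel   = suc y
  ; keeps  = λ i i<j → trans (upd-below a′ j _ i i<j) (keeps i i<j)
  ; void   = sweeps-none
  ; counts = λ x≤y → sweeps-counts 1≤x x≤y y<2x
  ; runs   = runs
  }
  where
  runs : ∀ f g cnt r → suc y ≤ f →
         outer g j (x + y ∸ 1) (upd a′ j (suc (x + y ∸ 1))) (cnt + sweeps x y) ≡ just r →
         afterLoop1 (suc y + g) x cnt (loop1 f j x y a) ≡ just r
  runs (suc f) g cnt r _ done
    rewrite loop1-exit f j x y a y<2x | run (suc y + g) cnt (s≤s (m≤m+n y g)) | sum≡ =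
    outer-mono+ (suc y) g j _ _ _ r done

-- In a branch frame the second subframe (x + 1 , y ∸ 1) can only be void
-- when y = 2 (and x = 1) ...
branch-void-edge : ∀ {x z} → 2 * x ≤ suc (suc z) → z < x → z ≡ 0
branch-void-edge {x} {z} 2x≤y z<x = n≤0⇒n≡0 (+-cancelˡ-≤ (suc z) z 0 (≤-pred (begin
  suc (suc z + z)  ≡⟨ sym (+-suc (suc z) z) ⟩
  suc z + suc z    ≤⟨ +-mono-≤ z<x z<x ⟩
  x + x            ≡⟨ sym (double x) ⟩
  2 * x            ≤⟨ 2x≤y ⟩
  suc (suc z)      ≡⟨ cong (suc ∘ suc) (sym (+-identityʳ z)) ⟩
  suc (suc z + 0)  ∎)))
  where open ≤-Reasoning

-- ... and then it has nothing to count, as Part 2 1 is empty.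
branch-void-empty : ∀ {x z} → 1 ≤ x → 2 * x ≤ suc (suc z) → z < x → ¬ Part (suc x) (x + z)
branch-void-empty {x} 1≤x 2x≤y z<x rewrite branch-void-edge 2x≤y z<x =
  Part-empty (subst (0 <_) (sym (+-identityʳ x)) 1≤x) (s≤s (≤-reflexive (+-identityʳ x)))

-- A branch frame (2x ≤ y): loop1 writes a_j ← x and enters the subframe
-- (x , y ∸ x) at position j + 1; when that returns, the outer loop resumes
-- at position j with trial value a_j + 1 = x + 1 and remaining y ∸ 1.  The
-- two counts add up by the recurrence split.
frame-branch : ∀ {x z j a} → 1 ≤ x → 1 ≤ j → 2 * x ≤ suc (suc z) →
  (first : Frame x (suc (suc z) ∸ x) (suc j) (upd a j x)) →
  Frame (suc x) (suc z) j (Frame.array first) →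
  Frame x (suc (suc z)) j a
frame-branch {x} {z} {j} {a} 1≤x 1≤j 2x≤y first second = record
  { visits = F₁.visits + F₂.visits
  ; array  = F₂.array
  ; fuel   = F₁.fuel + suc F₂.fuel
  ; keeps  = λ i i<j → trans (F₂.keeps i i<j)
                        (trans (F₁.keeps i (m<n⇒m<1+n i<j)) (upd-below a j x i i<j))
  ; void   = λ y<x → ⊥-elim (<⇒≱ y<x x≤y)
  ; counts = λ _ → counts
  ; runs   = runs
  }
  where
  module F₁ = Frame first
  module F₂ = Frame second
  y = suc (suc z)

  x+x≤y : x + x ≤ y
  x+x≤y = subst (_≤ y) (double x) 2x≤y

  x≤y : x ≤ y
  x≤y = ≤-trans (m≤m+n x x) x+x≤y

  x+[y∸x]≡y : x + (y ∸ x) ≡ y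
  x+[y∸x]≡y = m+[n∸m]≡n x≤y

  firstCounts : Fin F₁.visits ↔ Part x (x + z ∸ x)
  firstCounts = ↔-trans (F₁.counts (m+n≤o⇒m≤o∸n x x+x≤y))
                        (Part-cong (trans (cong (_∸ 2) x+[y∸x]≡y) (sym (m+n∸m≡n x z))))

  secondCounts : Fin F₂.visits ↔ Part (suc x) (x + z)
  secondCounts with suc x ≤? suc z
  ... | yes x<y = ↔-trans (F₂.counts x<y) (Part-cong (+1∸1 x z))
  ... | no  x≮y rewrite F₂.void (≰⇒> x≮y) =
    empty↔Fin0 (branch-void-empty 1≤x 2x≤y (≤-pred (≰⇒> x≮y)))

  counts : Fin (F₁.visits + F₂.visits) ↔ Part x (x + y ∸ 2)
  counts = ↔-trans (+↔⊎ {F₁.visits} {F₂.visits})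
             (↔-trans (firstCounts ⊎-↔ secondCounts)
               (↔-trans (↔-sym (split 1≤x (m≤m+n x z))) (Part-cong (sym (+2∸2 x z)))))

  -- a_j was set to x by loop1 and left alone by the subframe
  a₁[j]≡x : F₁.array j ≡ x
  a₁[j]≡x = trans (F₁.keeps j ≤-refl) (upd-eq a j x)

  resume : ∀ g cnt r → outer g j (x + y ∸ 1) F₂.array (cnt + (F₁.visits + F₂.visits)) ≡ just r →
           outer (suc (F₂.fuel + g)) (suc j) (x + (y ∸ x) ∸ 1) F₁.array (cnt + F₁.visits) ≡ just r
  resume g cnt r done = begin
    outer (suc (F₂.fuel + g)) (suc j) (x + (y ∸ x) ∸ 1) F₁.array (cnt + F₁.visits)
      ≡⟨ outer-step (F₂.fuel + g) (suc j) _ F₁.array _ (λ j+1≡1 → <⇒≢ 1≤j (sym (suc-injective j+1≡1))) ⟩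
    afterLoop1 (F₂.fuel + g) (F₁.array j + 1) (cnt + F₁.visits)
      (loop1 (F₂.fuel + g) j (F₁.array j + 1) (x + (y ∸ x) ∸ 1) F₁.array)
      ≡⟨ cong₂ (λ u v → afterLoop1 (F₂.fuel + g) u (cnt + F₁.visits) (loop1 (F₂.fuel + g) j u v F₁.array))
               (trans (cong (_+ 1) a₁[j]≡x) (+-comm x 1)) (cong (_∸ 1) x+[y∸x]≡y) ⟩
    afterLoop1 (F₂.fuel + g) (suc x) (cnt + F₁.visits) (loop1 (F₂.fuel + g) j (suc x) (suc z) F₁.array)
      ≡⟨ F₂.runs (F₂.fuel + g) g (cnt + F₁.visits) r (m≤m+n F₂.fuel g)
           (subst₂ (λ u c → outer g j u F₂.array c ≡ just r)
                   (+1∸1 x (suc z)) (sym (+-assoc cnt F₁.visits F₂.visits)) done) ⟩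
    just r ∎
    where open ≡-Reasoning

  runs : ∀ f g cnt r → F₁.fuel + suc F₂.fuel ≤ f →
         outer g j (x + y ∸ 1) F₂.array (cnt + (F₁.visits + F₂.visits)) ≡ just r →
         afterLoop1 (F₁.fuel + suc F₂.fuel + g) x cnt (loop1 f j x y a) ≡ just r
  runs zero g cnt r fuel≤0 _ = ⊥-elim (<⇒≱ (≤-trans (s≤s z≤n) (m≤n+m (suc F₂.fuel) F₁.fuel)) fuel≤0)
  runs (suc f) g cnt r fuel≤ done
    rewrite loop1-continue f j x y a 2x≤y | +-assoc F₁.fuel (suc F₂.fuel) g =
    F₁.runs f (suc (F₂.fuel + g)) cnt r fuel₁≤f (resume g cnt r done)
    where
    fuel₁≤f : F₁.fuel ≤ f
    fuel₁≤f = m+n≤o⇒m≤o F₁.fuel (≤-pred (subst (_≤ suc f) (+-suc F₁.fuel F₂.fuel) fuel≤))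

frame : ∀ y {x j} a → 1 ≤ x → 1 ≤ j → Frame x y j a
frame = <-rec (λ y → ∀ {x j} a → 1 ≤ x → 1 ≤ j → Frame x y j a) step
  where
  step : ∀ y → (∀ {y′} → y′ < y → ∀ {x j} a → 1 ≤ x → 1 ≤ j → Frame x y′ j a) →
         ∀ {x j} a → 1 ≤ x → 1 ≤ j → Frame x y j a
  step y rec {x} {j} a 1≤x 1≤j with 2 * x ≤? y
  ... | no 2x≰y = frame-leaf j a 1≤x (≰⇒> 2x≰y)
  step zero rec {x} a 1≤x 1≤j | yes 2x≤0 = ⊥-elim (<⇒≱ (≤-trans 1≤x (m≤m+n x _)) 2x≤0)
  step (suc zero) rec {x} a 1≤x 1≤j | yes 2x≤1 =
    ⊥-elim (<⇒≱ (+-mono-≤ 1≤x (≤-trans 1≤x (m≤m+n x 0))) 2x≤1)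
  step (suc (suc z)) rec {x} {j} a 1≤x 1≤j | yes 2x≤y =
    frame-branch 1≤x 1≤j 2x≤y first (rec ≤-refl (Frame.array first) (s≤s z≤n) 1≤j)
    where
    first : Frame x (suc (suc z) ∸ x) (suc j) (upd a j x)
    first = rec (∸-monoʳ-< 1≤x (≤-trans (m≤m+n x _) 2x≤y)) (upd a j x) 1≤x (s≤s z≤n)

-- Imported last: its prefix +_ would make sections like (x +_) ambiguous.
open import Data.Integer using (+_; _-_)

-- For n = 1 the run is checked by computation; for n ≥ 2 the first
-- iteration of the outer loop enters the frame (1 , n ∸ 1) at position 1,
-- which returns to position 1 where the outer loop stops, and
-- Part 1 (n ∸ 2) is PartitionOf (n ∸ 2).
lemma4p8 : (n : ℕ) → 1 ≤ n →
    Σ ℕ (λ fuel → Σ ℕ (λ c →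
      (accelAscInnerVisits fuel n ≡ just c) × (Fin c ↔ PartitionOfℤ ((+ n) - (+ 2)))))
lemma4p8 (suc zero) _ = 5 , 0 , refl , empty↔Fin0 (λ ())
lemma4p8 (suc (suc m)) _ = suc (fuel + 1) , visits , terminates , counts (s≤s z≤n)
  where
  initial : Array
  initial = upd (λ _ → 0) 1 0

  open Frame (frame (suc m) initial ≤-refl ≤-refl)

  terminates : accelAscInnerVisits (suc (fuel + 1)) (suc (suc m)) ≡ just visits
  terminates = trans (outer-step (fuel + 1) 2 (suc m) initial 0 (λ ()))
                     (runs (fuel + 1) 1 0 visits (m≤m+n fuel 1) refl)
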